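{- Let $G=(V,E,A)$ be a finite mixed graph and let $x,y$ be integers with $1\le y\le x$. Then \[ \chi_G(x,y) \;=\; \sum_{H \text{ flat of } G}\ \ \sum_{\sigma \text{ acyclic orientation of } H^{u}} \Omega^{\circ}_{\sigma,\, C(H)\cup T(\sigma)}(x,y). \]
   Context: A mixed graph $G=(V,E,A)$ has a finite vertex set $V$, a set $E$ of undirected edges and a set $A$ of arcs (directed edges). For integers $1\le y\le x$ and $[x]=\{1,\dots,x\}$, the bivariate chromatic polynomial $\chi_G(x,y)$ is the number of maps $c:V\to[x]$ such that for every edge $uv\in E$, $c(u)\ne c(v)$ or $c(u)>y$, and for every arc $\overrightarrow{uv}\in A$, $c(u)<c(v)$ or $c(u)>y$. Flats: a flat of $G$ is a mixed graph $H$ obtainable from $G$ by a sequence of contractions of edges and arcs (contracting identifies the two endpoints into one vertex; edges/arcs that end up joining a vertex to itself are discarded, all others are kept). Equivalently, a flat corresponds to a partition of $V$ into blocks each inducing a connected subgraph of the underlying undirected graph of $G$; $V(H)$ is the set of blocks, and each edge (resp. arc) of $G$ joining two different blocks gives an edge (resp. arc, with the same direction) of $H$ between those blocks. Distinct flats are summed once each. $V(H),E(H),A(H)$ denote the vertices, edges and arcs of $H$, and $C(H)\subseteq V(H)$ is the set of vertices of $H$ that arose from contractions (blocks containing at least two vertices of $G$). For a mixed graph $H$, $H^{u}$ is its underlying undirected (multi)graph, obtained by replacing each arc by an undirected edge. An acyclic orientation $\sigma$ of $H^u$ orients every edge so that there is no directed cycle. For such $\sigma$, $T(\sigma)=\{v\in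 V(H): \text{there is an arc } \overrightarrow{vw}\in A(H) \text{ whose underlying edge is oriented from } w \text{ to } v \text{ in } \sigma\}$. Bivariate order polynomial: $\sigma$ is regarded as a poset on $V(H)$ ($u\preceq v$ iff there is a directed path from $u$ to $v$ in $\sigma$). For a finite poset $P$ and a subset $C\subseteq P$ (the "celeste" elements), $\Omega^{\circ}_{P,C}(x,y)$ is the number of maps $\varphi:P\to[x]$ such that $a\prec b$ implies $\varphi(a)<\varphi(b)$ for all $a,b\in P$, and $\varphi(c)>y$ for all $c\in C$. -}

module Defs where

open import Data.Nat using (ℕ; zero; suc; _+_; _≡ᵇ_; _<ᵇ_; _≤ᵇ_)
open import Data.Fin using (Fin; toℕ)
open import Data.Bool using (Bool; true; false; _∧_; _∨_; not; if_then_else_)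
open import Data.List using (List; []; _∷_; _++_; map; concatMap; filterᵇ; length; allFin; upTo; zip; zipWith; drop)
open import Data.Bool.ListAction using (all; any)
open import Data.Nat.ListAction using (sum)
open import Data.List.Relation.Unary.All using (All)
open import Data.Product using (_×_; _,_; proj₁; proj₂)
open import Relation.Binary.PropositionalEquality using (_≢_)

-- Finite mixed graphs on vertex set Fin n.  Edges and arcs are lists of
-- pairs (multi-edges allowed).  An edge (u , v) is undirected; an arc
-- (u , v) is directed from u to v.

record MixedGraph (n : ℕ) : Set where
  field
    edges : List (Fin n × Fin n)
    arcs  : List (Fin n × Fin n)
open MixedGraph public

Loopless : ∀ {n} → MixedGraph n → Set
Loopless G = All (λ e → proj₁ e ≢ proj₂ e) (edges G)
           × All (λ e → proj₁ e ≢ proj₂ e) (arcs G)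

_≡ᶠ_ : ∀ {k} → Fin k → Fin k → Bool
i ≡ᶠ j = toℕ i ≡ᵇ toℕ j

-- all maps Fin n → A with values in the given list (each map listed once
-- when the value list has no duplicates)
maps : ∀ {A : Set} (n : ℕ) → List A → List (Fin n → A)
maps zero    vals = (λ ()) ∷ []
maps (suc n) vals =
  concatMap (λ a → map (λ f → λ { Fin.zero → a ; (Fin.suc i) → f i }) (maps n vals)) vals

bools : ℕ → List (List Bool)
bools zero    = [] ∷ []
bools (suc m) = concatMap (λ b → map (b ∷_) (bools m)) (true ∷ false ∷ [])

range : ℕ → List ℕ
range x = map suc (upTo x)

properEdge : ∀ {n} → ℕ → (Fin n → ℕ) → Fin n × Fin n → Bool
properEdge y c (u , v) = not (c u ≡ᵇ c v) ∨ (y <ᵇ c u)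

properArc : ∀ {n} → ℕ → (Fin n → ℕ) → Fin n × Fin n → Bool
properArc y c (u , v) = (c u <ᵇ c v) ∨ (y <ᵇ c u)

isColoring : ∀ {n} → MixedGraph n → ℕ → (Fin n → ℕ) → Bool
isColoring G y c = all (properEdge y c) (edges G) ∧ all (properArc y c) (arcs G)

χ : ∀ {n} → MixedGraph n → ℕ → ℕ → ℕ
χ {n} G x y = length (filterᵇ (isColoring G y) (maps n (range x)))

-- A partition of Fin n into k blocks is encoded uniquely by a
-- surjection q : Fin n → Fin k whose block labels appear in order of
-- first occurrence ("canonical"): for every v and every label j < q v,
-- some u < v has q u = j.

surjective : ∀ {n k} → (Fin n → Fin k) → Bool
surjective {n} {k} q = all (λ j → any (λ v → q v ≡ᶠ j) (allFin n)) (allFin k)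

canonical : ∀ {n k} → (Fin n → Fin k) → Bool
canonical {n} {k} q =
  all (λ v → all (λ j → not (toℕ j <ᵇ toℕ (q v))
                        ∨ any (λ u → (toℕ u <ᵇ toℕ v) ∧ (q u ≡ᶠ j)) (allFin n))
                 (allFin k))
      (allFin n)

adjU : ∀ {n} → MixedGraph n → Fin n → Fin n → Bool
adjU G u v = any (λ e → ((proj₁ e ≡ᶠ u) ∧ (proj₂ e ≡ᶠ v)) ∨ ((proj₁ e ≡ᶠ v) ∧ (proj₂ e ≡ᶠ u)))
                 (edges G ++ arcs G)

walkIn : ∀ {n k} → MixedGraph n → (Fin n → Fin k) → ℕ → Fin n → Fin n → Bool
walkIn G q zero    u v = u ≡ᶠ v
walkIn {n} G q (suc m) u v =
  walkIn G q m u v ∨ any (λ w → adjU G u w ∧ (q w ≡ᶠ q u) ∧ walkIn G q m w v) (allFin n)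

-- every block induces a connected subgraph of G^u
-- (walks of length ≤ n suffice, as any path has at most n-1 edges)
blocksConnected : ∀ {n k} → MixedGraph n → (Fin n → Fin k) → Bool
blocksConnected {n} G q =
  all (λ u → all (λ v → not (q u ≡ᶠ q v) ∨ walkIn G q n u v) (allFin n)) (allFin n)

isFlat : ∀ {n k} → MixedGraph n → (Fin n → Fin k) → Bool
isFlat G q = surjective q ∧ canonical q ∧ blocksConnected G q

-- the flat H determined by q (vertex set Fin k = set of blocks)
contractList : ∀ {n k} → (Fin n → Fin k) → List (Fin n × Fin n) → List (Fin k × Fin k)
contractList q es = map (λ e → (q (proj₁ e) , q (proj₂ e)))
                        (filterᵇ (λ e → not (q (proj₁ e) ≡ᶠ q (proj₂ e))) es)

flatEdges : ∀ {n k} → MixedGraph n → (Fin n → Fin k) → List (Fin k × Fin k)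
flatEdges G q = contractList q (edges G)

flatArcs : ∀ {n k} → MixedGraph n → (Fin n → Fin k) → List (Fin k × Fin k)
flatArcs G q = contractList q (arcs G)

contracted : ∀ {n k} → (Fin n → Fin k) → Fin k → Bool
contracted {n} q j = 2 ≤ᵇ length (filterᵇ (λ v → q v ≡ᶠ j) (allFin n))

-- Orientations of the underlying multigraph H^u, whose edge list is
-- flatEdges ++ flatArcs.  An orientation is a Boolean list of the same
-- length: true keeps (u , v) as u → v, false reverses it to v → u.

orient : ∀ {k} → List Bool → List (Fin k × Fin k) → List (Fin k × Fin k)
orient o L = zipWith (λ b e → if b then e else (proj₂ e , proj₁ e)) o L

dpath : ∀ {k} → List (Fin k × Fin k) → ℕ → Fin k → Fin k → Bool
dpath D zero    u v = false
dpath D (suc m) u v = any (λ e → (proj₁ e ≡ᶠ u) ∧ ((proj₂ e ≡ᶠ v) ∨ dpath D m (proj₂ e) v)) D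

-- u ≺ v in the poset σ (directed paths have length ≤ k)
prec : ∀ {k} → List (Fin k × Fin k) → Fin k → Fin k → Bool
prec {k} D u v = dpath D k u v

-- no directed cycle (every directed cycle has length ≤ k)
acyclic : ∀ {k} → List (Fin k × Fin k) → Bool
acyclic {k} D = all (λ v → not (dpath D k v v)) (allFin k)

-- T(σ): tails v of arcs v → w of H that σ orients from w to v
inT : ∀ {n k} → MixedGraph n → (Fin n → Fin k) → List Bool → Fin k → Bool
inT G q o v = any (λ p → not (proj₁ p) ∧ (proj₁ (proj₂ p) ≡ᶠ v))
                  (zip (drop (length (flatEdges G q)) o) (flatArcs G q))

Ω° : ∀ {k} → List (Fin k × Fin k) → (Fin k → Bool) → ℕ → ℕ → ℕ
Ω° {k} D C x y = length (filterᵇ ok (maps k (range x)))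
  where
    ok : (Fin k → ℕ) → Bool
    ok φ = all (λ a → all (λ b → not (prec D a b) ∨ (φ a <ᵇ φ b)) (allFin k)) (allFin k)
         ∧ all (λ c → not (C c) ∨ (y <ᵇ φ c)) (allFin k)

flatTerm : ∀ {n k} → MixedGraph n → (Fin n → Fin k) → ℕ → ℕ → ℕ
flatTerm G q x y =
  sum (map (λ o → Ω° (orient o L) (λ v → contracted q v ∨ inT G q o v) x y)
           (filterᵇ (λ o → acyclic (orient o L)) (bools (length L))))
  where L = flatEdges G q ++ flatArcs G q

flatSum : ∀ {n} → MixedGraph n → ℕ → ℕ → ℕ
flatSum {n} G x y =
  sum (map (λ k → sum (map (λ q → flatTerm G q x y)
                           (filterᵇ (isFlat G) (maps n (allFin k)))))
           (upTo (suc n)))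

-- Every term of the right-hand side is a flat q : V → V(H), an acyclic orientation σ and a map
-- φ : V(H) → [x]; sort the terms by the map c = φ ∘ q : V → [x]. Over a fixed c there is at most
-- one term: σ orients every edge of H strictly upwards for φ, so an edge or arc of G joining two
-- blocks is bichromatic, while blocks are connected and monochromatic; hence the blocks are exactly
-- the components of the monochromatic edges and arcs of c, φ is induced by c, and σ is the
-- orientation by increasing φ. Such a term exists iff c is proper: a contracted block contains a
-- monochromatic edge or arc, and a vertex of T(σ) is the tail of an arc whose colour does not
-- increase, so in both cases properness is exactly the requirement that its colour exceed y.
module Submission where

open import Defs
open import Algebra.Properties.CommutativeSemigroup using (interchange)
open import Data.Bool using (Bool; true; false; T; not; _∧_; _∨_; if_then_else_)
open import Data.Bool.ListAction using (all; any)
open import Data.Bool.Properties using (T-∧; T-∨; T-≡; T-not-≡)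
open import Data.Fin using (Fin; toℕ; fromℕ<) renaming (zero to fzero; suc to fsuc)
open import Data.Fin.Properties
  using (all?; toℕ-injective; injective⇒≤; toℕ<n; toℕ-fromℕ<; fromℕ<-toℕ; fromℕ<-cong;
         fromℕ<-injective)
  renaming (_≟_ to _≟ᶠ_)
open import Data.List
  using (List; []; _∷_; _++_; map; lookup; zip; drop; concatMap; cartesianProductWith; filter; filterᵇ;
         length; allFin; upTo)
open import Data.List.Membership.Propositional using (_∈_; find; lose)
open import Data.List.Membership.Propositional.Properties
  using (∈-allFin; ∈-lookup; ∈-filter⁺; ∈-filter⁻; ∈-++⁺ˡ; ∈-++⁺ʳ; ∈-++⁻; ∈-map⁺; ∈-map⁻; ∈-upTo⁺;
         ∈-upTo⁻; ∈-cartesianProductWith⁺; ∈-cartesianProductWith⁻)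
open import Data.List.Properties using (map-cong; map-cong-local; ∷-injective; length-map)
open import Data.List.Relation.Unary.All as All using ([]; _∷_)
open import Data.List.Relation.Unary.All.Properties using (all⁺; all⁻; ¬Any⇒All¬)
open import Data.List.Relation.Unary.Any as Any using (here; there)
open import Data.List.Relation.Unary.Any.Properties using (any⁺; any⁻)
open import Data.List.Relation.Unary.AllPairs using ([]; _∷_)
open import Data.List.Relation.Unary.Unique.Propositional using (Unique)
open import Data.List.Relation.Unary.Unique.Propositional.Properties using (allFin⁺; upTo⁺; filter⁺)
open import Data.List.Relation.Unary.Unique.Setoid using () renaming (Unique to Uniqueₛ)
import Data.List.Relation.Unary.Unique.Setoid.Properties as Uniqueₛ
open import Data.Nat
  using (ℕ; zero; suc; _+_; _≤_; _<_; _≮_; _≤′_; ≤′-refl; ≤′-step; _<?_; z≤n; s≤s; s≤s⁻¹;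
         z<s; _≡ᵇ_; _<ᵇ_)
open import Data.Nat.ListAction using (sum)
open import Data.Nat.Properties
open import Data.Product using (Σ; ∃; ∃₂; _×_; _,_; proj₁; proj₂)
open import Data.Product.Properties using (×-≡,≡→≡)
open import Data.Sum using (_⊎_; inj₁; inj₂) renaming (swap to ⊎-swap)
open import Function using (_∘_; _⇔_; mk⇔; Equivalence)
open import Level using (Level; 0ℓ)
open import Relation.Binary using (Setoid; Decidable; DecidableEquality; IsDecEquivalence; tri<; tri≈; tri>)
open import Relation.Binary.Construct.Closure.ReflexiveTransitive as Star using (Star; ε; _◅_; _◅◅_)
open import Relation.Binary.PropositionalEquality
open import Relation.Nullary using (¬_; Dec; yes; no; contradiction; map′; T?)

open Equivalence using (to; from)

T-→ : ∀ {a b} → T (not a ∨ b) ⇔ (T a → T b)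
T-→ {true}  = mk⇔ (λ b _ → b) (λ f → f _)
T-→ {false} = mk⇔ (λ _ ()) (λ _ → _)

T-not : ∀ {a} → T (not a) ⇔ (¬ T a)
T-not {true}  = mk⇔ (λ ()) (λ ¬t → ¬t _)
T-not {false} = mk⇔ (λ _ ()) (λ _ → _)

T-≡ᶠ : ∀ {n} {i j : Fin n} → T (i ≡ᶠ j) ⇔ i ≡ j
T-≡ᶠ {i = i} {j} = mk⇔ (toℕ-injective ∘ ≡ᵇ⇒≡ (toℕ i) (toℕ j))
                       (≡⇒≡ᵇ (toℕ i) (toℕ j) ∘ cong toℕ)

≡ᶠ-refl : ∀ {n} (i : Fin n) → T (i ≡ᶠ i)
≡ᶠ-refl i = from (T-≡ᶠ {i = i}) refl

T-all-allFin : ∀ {n} (p : Fin n → Bool) → T (all p (allFin n)) ⇔ (∀ i → T (p i))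
T-all-allFin p = mk⇔ (λ h i → All.lookup (all⁺ p (allFin _) h) (∈-allFin i))
                     (λ h → all⁻ p (All.tabulate {xs = allFin _} (λ {i} _ → h i)))

T-any-allFin : ∀ {n} (p : Fin n → Bool) → T (any p (allFin n)) ⇔ ∃ λ i → T (p i)
T-any-allFin p = mk⇔ (Any.satisfied ∘ any⁻ p (allFin _))
                     (λ (i , pᵢ) → any⁺ p (lose {P = T ∘ p} (∈-allFin i) pᵢ))

𝟙 : ∀ {p} {P : Set p} → Dec P → ℕ
𝟙 (yes _) = 1
𝟙 (no _)  = 0

module _ {p : Level} {P : Set p} where

  𝟙≤1 : ∀ (d : Dec P) → 𝟙 d ≤ 1
  𝟙≤1 (yes _) = s≤s z≤n
  𝟙≤1 (no _)  = z≤n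

  𝟙-positive : ∀ (d : Dec P) → 0 < 𝟙 d → P
  𝟙-positive (yes p) _ = p

  𝟙-yes : ∀ (d : Dec P) → P → 𝟙 d ≡ 1
  𝟙-yes (yes _) _ = refl
  𝟙-yes (no ¬p) p = contradiction p ¬p

if-positive : ∀ b {m} → 0 < (if b then m else 0) → T b × 0 < m
if-positive true pos = _ , pos

if-T : ∀ {b} m → T b → (if b then m else 0) ≡ m
if-T {true} _ _ = refl

if≤1 : ∀ b {m} → m ≤ 1 → (if b then m else 0) ≤ 1
if≤1 true  m≤1 = m≤1
if≤1 false _   = z≤n

module _ {A : Set} where

  sum-map-cong : ∀ {f g : A → ℕ} xs → (∀ {a} → a ∈ xs → f a ≡ g a) →
                 sum (map f xs) ≡ sum (map g xs)
  sum-map-cong xs f≡g = cong sum (map-cong-local (All.tabulate f≡g))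

  sum-map-0 : ∀ xs → sum (map (λ (_ : A) → 0) xs) ≡ 0
  sum-map-0 []       = refl
  sum-map-0 (_ ∷ xs) = sum-map-0 xs

  sum-map-+ : ∀ (f g : A → ℕ) xs → sum (map (λ a → f a + g a) xs) ≡ sum (map f xs) + sum (map g xs)
  sum-map-+ f g []       = refl
  sum-map-+ f g (x ∷ xs) =
    trans (cong (f x + g x +_) (sum-map-+ f g xs)) (interchange +-commutativeSemigroup (f x) (g x) _ _)

  sum-map-if : ∀ b (f : A → ℕ) xs →
               (if b then sum (map f xs) else 0) ≡ sum (map (λ a → if b then f a else 0) xs)
  sum-map-if true  f xs = refl
  sum-map-if false f xs = sym (sum-map-0 xs)

  sum-map-filterᵇ : ∀ p (f : A → ℕ) xs →
                    sum (map f (filterᵇ p xs)) ≡ sum (map (λ a → if p a then f a else 0) xs)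
  sum-map-filterᵇ p f []       = refl
  sum-map-filterᵇ p f (x ∷ xs) with p x
  ... | true  = cong (f x +_) (sum-map-filterᵇ p f xs)
  ... | false = sum-map-filterᵇ p f xs

  length-filterᵇ : ∀ p (xs : List A) →
                   length (filterᵇ p xs) ≡ sum (map (λ a → if p a then 1 else 0) xs)
  length-filterᵇ p []       = refl
  length-filterᵇ p (x ∷ xs) with p x
  ... | true  = cong suc (length-filterᵇ p xs)
  ... | false = length-filterᵇ p xs

  ≤-sum-map : ∀ (f : A → ℕ) {xs a} → a ∈ xs → f a ≤ sum (map f xs)
  ≤-sum-map f (here refl)           = m≤m+n _ _
  ≤-sum-map f {x ∷ _} (there a∈xs) = ≤-trans (≤-sum-map f a∈xs) (m≤n+m _ (f x))

  sum-map-positive : ∀ (f : A → ℕ) xs → 0 < sum (map f xs) → ∃ λ a → a ∈ xs × 0 < f a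
  sum-map-positive f (x ∷ xs) pos with f x in fx≡
  ... | suc _ = x , here refl , subst (0 <_) (sym fx≡) z<s
  ... | zero  = let a , a∈xs , fa>0 = sum-map-positive f xs pos in a , there a∈xs , fa>0

module _ {A B : Set} where

  sum-map-comm : ∀ (f : A → B → ℕ) xs ys →
                 sum (map (λ a → sum (map (f a) ys)) xs) ≡
                 sum (map (λ b → sum (map (λ a → f a b) xs)) ys)
  sum-map-comm f []       ys = sym (sum-map-0 ys)
  sum-map-comm f (x ∷ xs) ys =
    trans (cong (sum (map (f x) ys) +_) (sum-map-comm f xs ys)) (sym (sum-map-+ (f x) _ ys))

  sum-map-if-comm : ∀ (p : A → Bool) (g : A → B → ℕ) xs ys →
                    sum (map (λ a → if p a then sum (map (g a) ys) else 0) xs) ≡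
                    sum (map (λ b → sum (map (λ a → if p a then g a b else 0) xs)) ys)
  sum-map-if-comm p g xs ys =
    trans (cong sum (map-cong (λ a → sum-map-if (p a) (g a) ys) xs)) (sum-map-comm _ xs ys)

  sum-map-filterᵇ-comm : ∀ (p : A → Bool) (F : A → ℕ) (g : A → B → ℕ) xs ys →
                         (∀ a → F a ≡ sum (map (g a) ys)) →
                         sum (map F (filterᵇ p xs)) ≡
                         sum (map (λ b → sum (map (λ a → if p a then g a b else 0) xs)) ys)
  sum-map-filterᵇ-comm p F g xs ys F≡ =
    trans (sum-map-filterᵇ p F xs)
          (trans (cong sum (map-cong (λ a → cong (λ m → if p a then m else 0) (F≡ a)) xs))
                 (sum-map-if-comm p g xs ys))

module _ {ℓ : Level} (S : Setoid 0ℓ ℓ) where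

  open Setoid S using (Carrier; _≈_)

  sum-map≤1 : ∀ (f : Carrier → ℕ) {xs} → Uniqueₛ S xs → (∀ {a} → a ∈ xs → f a ≤ 1) →
              (∀ {a b} → a ∈ xs → b ∈ xs → 0 < f a → 0 < f b → a ≈ b) → sum (map f xs) ≤ 1
  sum-map≤1 f {[]} _ _ _ = z≤n
  sum-map≤1 f {x ∷ xs} (x≉xs ∷ xs!) f≤1 agree with 0 <? f x
  ... | no fx≯0 = begin
    f x + sum (map f xs) ≡⟨ cong (_+ sum (map f xs)) (n≤0⇒n≡0 (≮⇒≥ fx≯0)) ⟩
    sum (map f xs)       ≤⟨ sum-map≤1 f xs! (f≤1 ∘ there) (λ a∈ → agree (there a∈) ∘ there) ⟩
    1                    ∎
    where open ≤-Reasoning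
  ... | yes fx>0 = begin
    f x + sum (map f xs) ≡⟨ cong (f x +_) rest≡0 ⟩
    f x + 0              ≡⟨ +-identityʳ (f x) ⟩
    f x                  ≤⟨ f≤1 (here refl) ⟩
    1                    ∎
    where
    open ≤-Reasoning
    rest≡0 : sum (map f xs) ≡ 0
    rest≡0 = trans (sum-map-cong xs (λ a∈ → n≤0⇒n≡0 (≮⇒≥ λ fa>0 →
                      All.lookup x≉xs a∈ (agree (here refl) (there a∈) fx>0 fa>0))))
                   (sum-map-0 xs)

  sum-map-𝟙≡1 : ∀ (_≈?_ : Decidable _≈_) {xs} z → Uniqueₛ S xs →
                ∃ (λ a → a ∈ xs × z ≈ a) → sum (map (λ a → 𝟙 (z ≈? a)) xs) ≡ 1
  sum-map-𝟙≡1 _≈?_ z xs! (a , a∈xs , z≈a) =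
    ≤-antisym (sum-map≤1 _ xs! (λ {b} _ → 𝟙≤1 (z ≈? b)) agree)
              (≤-trans (≤-reflexive (sym (𝟙-yes (z ≈? a) z≈a))) (≤-sum-map _ a∈xs))
    where
    agree : ∀ {a b} → a ∈ _ → b ∈ _ → 0 < 𝟙 (z ≈? a) → 0 < 𝟙 (z ≈? b) → a ≈ b
    agree {a} {b} _ _ pa pb =
      Setoid.trans S (Setoid.sym S (𝟙-positive (z ≈? a) pa)) (𝟙-positive (z ≈? b) pb)

module _ {A B C : Set} (f : A → B → C) where

  concatMap≡cartesianProductWith : ∀ xs ys →
                                   concatMap (λ a → map (f a) ys) xs ≡ cartesianProductWith f xs ys
  concatMap≡cartesianProductWith []       ys = refl
  concatMap≡cartesianProductWith (x ∷ xs) ys =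
    cong (map (f x) ys ++_) (concatMap≡cartesianProductWith xs ys)

  ∈-concatMap-map⁺ : ∀ {xs ys a b} → a ∈ xs → b ∈ ys →
                     f a b ∈ concatMap (λ a → map (f a) ys) xs
  ∈-concatMap-map⁺ {xs} {ys} {a} {b} a∈ b∈ =
    subst (f a b ∈_) (sym (concatMap≡cartesianProductWith xs ys)) (∈-cartesianProductWith⁺ f a∈ b∈)

  ∈-concatMap-map⁻ : ∀ xs ys {v} → v ∈ concatMap (λ a → map (f a) ys) xs →
                     ∃₂ λ a b → a ∈ xs × b ∈ ys × v ≡ f a b
  ∈-concatMap-map⁻ xs ys {v} v∈ =
    ∈-cartesianProductWith⁻ f xs ys (subst (v ∈_) (concatMap≡cartesianProductWith xs ys) v∈)

module _ {A : Set} where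

  maps-unique : ∀ n {vals : List A} → Unique vals → Uniqueₛ (Fin n →-setoid A) (maps n vals)
  maps-unique zero    _     = [] ∷ []
  maps-unique (suc n) {vals} vals! =
    subst (Uniqueₛ (Fin (suc n) →-setoid A)) (sym (concatMap≡cartesianProductWith _ vals (maps n vals)))
          (Uniqueₛ.cartesianProductWith⁺ (setoid A) (Fin n →-setoid A) (Fin (suc n) →-setoid A)
             _ (λ eq → eq fzero , eq ∘ fsuc) vals! (maps-unique n vals!))

  ∈-maps⁻ : ∀ n {vals : List A} {g} → g ∈ maps n vals → ∀ i → g i ∈ vals
  ∈-maps⁻ (suc n) {vals} g∈ i with ∈-concatMap-map⁻ _ vals (maps n vals) g∈
  ... | a , h , a∈ , h∈ , refl with i
  ... | fzero  = a∈
  ... | fsuc i = ∈-maps⁻ n h∈ i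

  ∈-maps⁺ : ∀ n {vals : List A} (f : Fin n → A) → (∀ i → f i ∈ vals) →
            ∃ λ g → g ∈ maps n vals × g ≗ f
  ∈-maps⁺ zero    f _  = _ , here refl , λ ()
  ∈-maps⁺ (suc n) f f∈ =
    let g , g∈ , g≗ = ∈-maps⁺ n (f ∘ fsuc) (f∈ ∘ fsuc) in
    _ , ∈-concatMap-map⁺ _ (f∈ fzero) g∈ , λ { fzero → refl ; (fsuc i) → g≗ i }

bools-unique : ∀ m → Unique (bools m)
bools-unique zero    = [] ∷ []
bools-unique (suc m) =
  subst Unique (sym (concatMap≡cartesianProductWith _∷_ (true ∷ false ∷ []) (bools m)))
        (Uniqueₛ.cartesianProductWith⁺ (setoid Bool) (setoid (List Bool)) (setoid (List Bool))
           _∷_ ∷-injective (((λ ()) ∷ []) ∷ [] ∷ []) (bools-unique m))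

∈-bools⁺ : ∀ o → o ∈ bools (length o)
∈-bools⁺ []          = here refl
∈-bools⁺ (true ∷ o)  = ∈-concatMap-map⁺ _∷_ {true ∷ false ∷ []} (here refl) (∈-bools⁺ o)
∈-bools⁺ (false ∷ o) = ∈-concatMap-map⁺ _∷_ {true ∷ false ∷ []} (there (here refl)) (∈-bools⁺ o)

∈-bools⁻ : ∀ m {o} → o ∈ bools m → length o ≡ m
∈-bools⁻ zero (here refl) = refl
∈-bools⁻ (suc m) o∈
  with _ , o′ , _ , o′∈ , refl ← ∈-concatMap-map⁻ _∷_ (true ∷ false ∷ []) (bools m) o∈ =
  cong suc (∈-bools⁻ m o′∈)

range-unique : ∀ x → Unique (range x)
range-unique x = Uniqueₛ.map⁺ (setoid ℕ) (setoid ℕ) suc-injective (upTo⁺ x)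

∈-range⁻ : ∀ {x a} → a ∈ range x → a < suc x
∈-range⁻ a∈ with _ , b∈ , refl ← ∈-map⁻ suc a∈ = s≤s (∈-upTo⁻ b∈)

_≗?_ : ∀ {n} → Decidable (_≗_ {A = Fin n} {B = ℕ})
f ≗? g = all? (λ i → f i ≟ g i)

∈⇒1≤length : ∀ {A : Set} {a : A} {xs} → a ∈ xs → 1 ≤ length xs
∈⇒1≤length (here _)  = s≤s z≤n
∈⇒1≤length (there _) = s≤s z≤n

two-members⇔2≤length : ∀ {A : Set} {xs : List A} → Unique xs →
                       (∃₂ λ a b → a ≢ b × a ∈ xs × b ∈ xs) ⇔ 2 ≤ length xs
two-members⇔2≤length {xs = xs} xs! = mk⇔ two⇒2≤ (2≤⇒two xs xs!)
  where
  two⇒2≤ : (∃₂ λ a b → a ≢ b × a ∈ xs × b ∈ xs) → 2 ≤ length xs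
  two⇒2≤ (_ , _ , a≢b , here refl , here refl) = contradiction refl a≢b
  two⇒2≤ (_ , _ , _   , here refl , there b∈)  = s≤s (∈⇒1≤length b∈)
  two⇒2≤ (_ , _ , _   , there a∈  , _)         = s≤s (∈⇒1≤length a∈)
  2≤⇒two : ∀ xs → Unique xs → 2 ≤ length xs → ∃₂ λ a b → a ≢ b × a ∈ xs × b ∈ xs
  2≤⇒two (_ ∷ [])    _                 (s≤s ())
  2≤⇒two (a ∷ b ∷ _) ((a≢b ∷ _) ∷ _) _ = a , b , a≢b , here refl , there (here refl)

lookup-injective : ∀ {A : Set} {xs : List A} → Unique xs →
                   ∀ {i j} → lookup xs i ≡ lookup xs j → i ≡ j
lookup-injective (_  ∷ _)   {fzero}  {fzero}  _  = refl
lookup-injective (x≢ ∷ _)   {fzero}  {fsuc j} eq = contradiction eq (All.lookup x≢ (∈-lookup j))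
lookup-injective (x≢ ∷ _)   {fsuc i} {fzero}  eq = contradiction (sym eq) (All.lookup x≢ (∈-lookup i))
lookup-injective (_  ∷ xs!) {fsuc i} {fsuc j} eq = cong fsuc (lookup-injective xs! eq)

length-unique≤ : ∀ {n} {xs : List (Fin n)} → Unique xs → length xs ≤ n
length-unique≤ xs! = injective⇒≤ (lookup-injective xs!)

module _ {A : Set} {R : A → A → Set} where

  sources : ∀ {u v} → Star R u v → List A
  sources ε             = []
  sources (_◅_ {u} _ s) = u ∷ sources s

  private
    suffix : ∀ {u v a} (s : Star R u v) → a ∈ sources s → Unique (sources s) →
             Σ (Star R a v) (Unique ∘ sources)
    suffix (r ◅ s) (here refl) s!       = r ◅ s , s!
    suffix (r ◅ s) (there a∈)  (_ ∷ s!) = suffix s a∈ s!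

  loop-erase : DecidableEquality A → ∀ {u v} → Star R u v → Σ (Star R u v) (Unique ∘ sources)
  loop-erase _≟_ ε = ε , []
  loop-erase _≟_ (_◅_ {u} r s) with loop-erase _≟_ s
  ... | s′ , s′! with Any.any? (u ≟_) (sources s′)
  ... | yes u∈ = suffix s′ u∈ s′!
  ... | no  u∉ = r ◅ s′ , ¬Any⇒All¬ _ u∉ ∷ s′!

drop-map-++ : ∀ {A B : Set} (f : A → B) xs ys → drop (length xs) (map f (xs ++ ys)) ≡ map f ys
drop-map-++ f []       ys = refl
drop-map-++ f (_ ∷ xs) ys = drop-map-++ f xs ys

zip-map-self : ∀ {A B : Set} (f : A → B) xs → zip (map f xs) xs ≡ map (λ a → f a , a) xs
zip-map-self f []       = refl
zip-map-self f (x ∷ xs) = cong (_ ∷_) (zip-map-self f xs)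

-- Canonical labellings

module _ (p : ℕ → Bool) where

  #below : ℕ → ℕ
  #below zero    = 0
  #below (suc m) = if p m then suc (#below m) else #below m

  #below-≤ : ∀ m → #below m ≤ m
  #below-≤ zero = z≤n
  #below-≤ (suc m) with p m
  ... | true  = s≤s (#below-≤ m)
  ... | false = m≤n⇒m≤1+n (#below-≤ m)

  #below-step : ∀ m → #below m ≤ #below (suc m)
  #below-step m with p m
  ... | true  = n≤1+n _
  ... | false = ≤-refl

  #below-hit : ∀ {i} → T (p i) → #below i < #below (suc i)
  #below-hit {i} pᵢ with p i
  ... | true = n<1+n _

  #below-mono : ∀ {m m′} → m ≤ m′ → #below m ≤ #below m′
  #below-mono = mono ∘ ≤⇒≤′
    where
    mono : ∀ {m m′} → m ≤′ m′ → #below m ≤ #below m′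
    mono ≤′-refl      = ≤-refl
    mono (≤′-step le) = ≤-trans (mono le) (#below-step _)

  #below-strict : ∀ {i m} → T (p i) → i < m → #below i < #below m
  #below-strict pᵢ i<m = <-≤-trans (#below-hit pᵢ) (#below-mono i<m)

  #below-select : ∀ m {j} → j < #below m → ∃ λ i → i < m × T (p i) × #below i ≡ j
  #below-select (suc m) {j} j< with p m in pₘ
  ... | false = let i , i<m , pᵢ , eq = #below-select m j< in i , m<n⇒m<1+n i<m , pᵢ , eq
  ... | true with m≤n⇒m<n∨m≡n (s≤s⁻¹ j<)
  ...   | inj₁ j<b = let i , i<m , pᵢ , eq = #below-select m j<b in i , m<n⇒m<1+n i<m , pᵢ , eq
  ...   | inj₂ refl = m , n<1+n m , from T-≡ pₘ , refl

module _ {n : ℕ} where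

  extend : (Fin n → Bool) → ℕ → Bool
  extend p i with i <? n
  ... | yes i<n = p (fromℕ< i<n)
  ... | no  _   = false

  extend-toℕ : ∀ p u → extend p (toℕ u) ≡ p u
  extend-toℕ p u with toℕ u <? n
  ... | yes u<n = cong p (fromℕ<-toℕ u u<n)
  ... | no  u≮n = contradiction (toℕ<n u) u≮n

  extend⁻ : ∀ p {i} → T (extend p i) → ∃ λ u → toℕ u ≡ i × T (p u)
  extend⁻ p {i} h with i <? n
  ... | yes i<n = fromℕ< i<n , toℕ-fromℕ< i<n , h

least : ∀ {n} {P : Fin n → Set} → (∀ i → Dec (P i)) → ∀ {v} → P v →
        ∃ λ u → P u × ∀ {w} → P w → toℕ u ≤ toℕ w
least {suc n} P? {v} pᵥ with P? fzero
least P? {v}      pᵥ | yes p₀ = fzero , p₀ , λ _ → z≤n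
least P? {fzero}  pᵥ | no ¬p₀ = contradiction pᵥ ¬p₀
least P? {fsuc v} pᵥ | no ¬p₀ =
  let u , pᵤ , min = least (P? ∘ fsuc) pᵥ in
  fsuc u , pᵤ , λ { {fzero} p → contradiction p ¬p₀ ; {fsuc w} p → s≤s (min p) }

Onto : ∀ {n k} → (Fin n → Fin k) → Set
Onto q = ∀ j → ∃ λ v → q v ≡ j

Canonical : ∀ {n k} → (Fin n → Fin k) → Set
Canonical q = ∀ v {j} → toℕ j < toℕ (q v) → ∃ λ u → toℕ u < toℕ v × q u ≡ j

onto-factor-unique : ∀ {n k} {A : Set} {q : Fin n → Fin k} {φ φ′ : Fin k → A} {c : Fin n → A} →
                     Onto q → (∀ v → φ (q v) ≡ c v) → (∀ v → φ′ (q v) ≡ c v) → φ ≗ φ′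
onto-factor-unique onto factors factors′ j with v , refl ← onto j = trans (factors v) (sym (factors′ v))

record CanonicalLabelling {n} (R : Fin n → Fin n → Set) (k : ℕ) (q : Fin n → Fin k) : Set where
  field
    onto        : Onto q
    isCanonical : Canonical q
    kernel      : ∀ {a b} → q a ≡ q b ⇔ R a b

module _ {n : ℕ} {R : Fin n → Fin n → Set} where

  open CanonicalLabelling

  canonicalLabelling-cong : ∀ {k} {q q′ : Fin n → Fin k} → q ≗ q′ →
                            CanonicalLabelling R k q → CanonicalLabelling R k q′
  canonicalLabelling-cong q≗q′ L = record
    { onto        = λ j → let v , qv≡ = onto L j in v , trans (sym (q≗q′ v)) qv≡
    ; isCanonical = λ v j< →
        let u , u< , qu≡ = isCanonical L v (subst (λ i → _ < toℕ i) (sym (q≗q′ v)) j<)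
        in u , u< , trans (sym (q≗q′ u)) qu≡
    ; kernel      = λ {a} {b} → mk⇔
        (λ q′a≡q′b → to (kernel L) (trans (q≗q′ a) (trans q′a≡q′b (sym (q≗q′ b)))))
        (λ aRb → trans (sym (q≗q′ a)) (trans (from (kernel L) aRb) (q≗q′ b)))
    }

  private
    no-smaller : ∀ {k k′} {q : Fin n → Fin k} {q′ : Fin n → Fin k′} →
                 CanonicalLabelling R k q → CanonicalLabelling R k′ q′ →
                 ∀ v → (∀ u → toℕ u < toℕ v → toℕ (q u) ≡ toℕ (q′ u)) →
                 toℕ (q v) ≮ toℕ (q′ v)
    no-smaller {k′ = k′} {q} {q′} L L′ v agree qv<q′v = <-irrefl (sym q′v≡qv) qv<q′v
      where
      qv<k′ : toℕ (q v) < k′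
      qv<k′ = <-trans qv<q′v (toℕ<n (q′ v))
      earlier : ∃ λ u → toℕ u < toℕ v × q′ u ≡ fromℕ< qv<k′
      earlier = isCanonical L′ v (subst (_< toℕ (q′ v)) (sym (toℕ-fromℕ< qv<k′)) qv<q′v)
      q′u≡qv : toℕ (q′ (proj₁ earlier)) ≡ toℕ (q v)
      q′u≡qv = trans (cong toℕ (proj₂ (proj₂ earlier))) (toℕ-fromℕ< qv<k′)
      q′v≡qv : toℕ (q′ v) ≡ toℕ (q v)
      q′v≡qv =
        let qu≡qv = toℕ-injective (trans (agree _ (proj₁ (proj₂ earlier))) q′u≡qv)
        in trans (cong toℕ (sym (from (kernel L′) (to (kernel L) qu≡qv)))) q′u≡qv

    fewer-blocks : ∀ {k k′} {q : Fin n → Fin k} {q′ : Fin n → Fin k′} → Onto q′ →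
                   (∀ v → toℕ (q v) ≡ toℕ (q′ v)) → k′ ≤ k
    fewer-blocks {q = q} onto′ agree = ≮⇒≥ λ k<k′ →
      let v , q′v≡ = onto′ (fromℕ< k<k′) in
      <-irrefl (trans (agree v) (trans (cong toℕ q′v≡) (toℕ-fromℕ< k<k′))) (toℕ<n (q v))

  canonicalLabelling-unique : ∀ {k k′} {q : Fin n → Fin k} {q′ : Fin n → Fin k′} →
                              CanonicalLabelling R k q → CanonicalLabelling R k′ q′ →
                              k ≡ k′ × (∀ v → toℕ (q v) ≡ toℕ (q′ v))
  canonicalLabelling-unique {q = q} {q′} L L′ =
    ≤-antisym (fewer-blocks (onto L) (sym ∘ agree)) (fewer-blocks (onto L′) agree) , agree
    where
    agree-below : ∀ m v → toℕ v < m → toℕ (q v) ≡ toℕ (q′ v)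
    agree-below (suc m) v v<m =
      ≤-antisym (≮⇒≥ (no-smaller L′ L v (λ u → sym ∘ IH u))) (≮⇒≥ (no-smaller L L′ v IH))
      where
      IH : ∀ u → toℕ u < toℕ v → toℕ (q u) ≡ toℕ (q′ u)
      IH u u<v = agree-below m u (<-≤-trans u<v (s≤s⁻¹ v<m))
    agree : ∀ v → toℕ (q v) ≡ toℕ (q′ v)
    agree v = agree-below n v (toℕ<n v)

-- A class is labelled by the number of leaders (least members of classes) below its own leader, so
-- labels appear in order of first occurrence.
module _ {n : ℕ} {R : Fin n → Fin n → Set} (R-isDecEquivalence : IsDecEquivalence R) where

  open IsDecEquivalence R-isDecEquivalence using ()
    renaming (refl to R-refl; sym to R-sym; trans to R-trans; _≟_ to _R?_)

  private
    leader : Fin n → Fin n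
    leader v = proj₁ (least (_R? v) R-refl)

    leader-R : ∀ v → R (leader v) v
    leader-R v = proj₁ (proj₂ (least (_R? v) R-refl))

    leader-minimal : ∀ {u v} → R u v → toℕ (leader v) ≤ toℕ u
    leader-minimal {v = v} = proj₂ (proj₂ (least (_R? v) R-refl))

    leader-cong : ∀ {u v} → R u v → leader u ≡ leader v
    leader-cong {u} {v} uRv = toℕ-injective (≤-antisym
      (leader-minimal (R-trans (leader-R v) (R-sym uRv)))
      (leader-minimal (R-trans (leader-R u) uRv)))

    isLeader : Fin n → Bool
    isLeader u = leader u ≡ᶠ u

    leader-isLeader : ∀ v → T (isLeader (leader v))
    leader-isLeader v = from T-≡ᶠ (leader-cong (leader-R v))

    rank : ℕ → ℕ
    rank = #below (extend isLeader)

    rank-hit : ∀ {u} → T (isLeader u) → T (extend isLeader (toℕ u))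
    rank-hit {u} = subst T (sym (extend-toℕ isLeader u))

    rank-leader< : ∀ v → rank (toℕ (leader v)) < rank n
    rank-leader< v = #below-strict _ (rank-hit (leader-isLeader v)) (toℕ<n (leader v))

    label : Fin n → Fin (rank n)
    label v = fromℕ< (rank-leader< v)

    toℕ-label : ∀ v → toℕ (label v) ≡ rank (toℕ (leader v))
    toℕ-label v = toℕ-fromℕ< (rank-leader< v)

    leaders-separated : ∀ {u w} → T (isLeader u) → T (isLeader w) →
                        rank (toℕ u) ≡ rank (toℕ w) → u ≡ w
    leaders-separated {u} {w} hu hw eq with <-cmp (toℕ u) (toℕ w)
    ... | tri≈ _ u≡w _ = toℕ-injective u≡w
    ... | tri< u<w _ _ = contradiction eq (<⇒≢ (#below-strict _ (rank-hit hu) u<w))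
    ... | tri> _ _ w<u = contradiction (sym eq) (<⇒≢ (#below-strict _ (rank-hit hw) w<u))

    kernel : ∀ {a b} → label a ≡ label b ⇔ R a b
    kernel {a} {b} = mk⇔ same-block⇒R R⇒same-block
      where
      same-block⇒R : label a ≡ label b → R a b
      same-block⇒R eq =
        let same-leader = leaders-separated (leader-isLeader a) (leader-isLeader b)
                            (trans (sym (toℕ-label a)) (trans (cong toℕ eq) (toℕ-label b)))
        in R-trans (R-sym (leader-R a)) (subst (λ u → R u b) (sym same-leader) (leader-R b))
      R⇒same-block : R a b → label a ≡ label b
      R⇒same-block aRb = toℕ-injective (begin
        toℕ (label a)          ≡⟨ toℕ-label a ⟩
        rank (toℕ (leader a))  ≡⟨ cong (rank ∘ toℕ) (leader-cong aRb) ⟩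
        rank (toℕ (leader b))  ≡⟨ toℕ-label b ⟨
        toℕ (label b)          ∎)
        where open ≡-Reasoning

    leader-of-rank : ∀ {m j} → j < rank m → ∃ λ u → toℕ u < m × toℕ (label u) ≡ j
    leader-of-rank {m} j< =
      let i , i<m , hit , rank≡j = #below-select _ m j<
          u , u≡i , isL          = extend⁻ isLeader hit
          leader≡u               = to (T-≡ᶠ {i = leader u} {u}) isL
      in u , subst (_< m) (sym u≡i) i<m ,
         trans (toℕ-label u) (trans (cong (rank ∘ toℕ) leader≡u) (trans (cong rank u≡i) rank≡j))

  canonicalLabelling : ∃₂ λ k (q : Fin n → Fin k) → k ≤ n × CanonicalLabelling R k q
  canonicalLabelling = rank n , label , #below-≤ _ n , record
    { onto        = λ j → let u , _ , eq = leader-of-rank {n} (toℕ<n j) in u , toℕ-injective eq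
    ; isCanonical = λ v j< →
        let u , u<ℓ , eq = leader-of-rank (subst (_ <_) (toℕ-label v) j<)
        in u , <-≤-trans u<ℓ (leader-minimal R-refl) , toℕ-injective eq
    ; kernel      = kernel
    }

Joins : ∀ {n} → Fin n → Fin n → Fin n × Fin n → Set
Joins u w e = e ≡ (u , w) ⊎ e ≡ (w , u)

Step : ∀ {n} {A : Set} → MixedGraph n → (Fin n → A) → Fin n → Fin n → Set
Step G ℓ u w = T (adjU G u w) × ℓ w ≡ ℓ u

Linked : ∀ {n} {A : Set} → MixedGraph n → (Fin n → A) → Fin n → Fin n → Set
Linked G ℓ = Star (Step G ℓ)

module _ {n : ℕ} (G : MixedGraph n) where

  T-adjU : ∀ {u w} → T (adjU G u w) ⇔ ∃ λ e → e ∈ edges G ++ arcs G × Joins u w e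
  T-adjU {u} {w} = mk⇔
    (λ h → let e , e∈ , pₑ = find (any⁻ _ (edges G ++ arcs G) h) in e , e∈ , joins e pₑ)
    (λ (e , e∈ , j) → any⁺ _ (lose {P = T ∘ P} e∈ (unjoins e j)))
    where
    P : Fin n × Fin n → Bool
    P e = ((proj₁ e ≡ᶠ u) ∧ (proj₂ e ≡ᶠ w)) ∨ ((proj₁ e ≡ᶠ w) ∧ (proj₂ e ≡ᶠ u))
    ends : ∀ {a b} e → T ((proj₁ e ≡ᶠ a) ∧ (proj₂ e ≡ᶠ b)) → e ≡ (a , b)
    ends e h = let h₁ , h₂ = to T-∧ h in ×-≡,≡→≡ (to T-≡ᶠ h₁ , to T-≡ᶠ h₂)
    joins : ∀ e → T (P e) → Joins u w e
    joins e h with to (T-∨ {(proj₁ e ≡ᶠ u) ∧ (proj₂ e ≡ᶠ w)}) h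
    ... | inj₁ h′ = inj₁ (ends e h′)
    ... | inj₂ h′ = inj₂ (ends e h′)
    unjoins : ∀ e → Joins u w e → T (P e)
    unjoins _ (inj₁ refl) = from (T-∨ {(u ≡ᶠ u) ∧ (w ≡ᶠ w)} {(u ≡ᶠ w) ∧ (w ≡ᶠ u)})
                                 (inj₁ (from (T-∧ {u ≡ᶠ u}) (≡ᶠ-refl u , ≡ᶠ-refl w)))
    unjoins _ (inj₂ refl) = from (T-∨ {(w ≡ᶠ u) ∧ (u ≡ᶠ w)} {(w ≡ᶠ w) ∧ (u ≡ᶠ u)})
                                 (inj₂ (from (T-∧ {w ≡ᶠ w}) (≡ᶠ-refl w , ≡ᶠ-refl u)))

  adjU-sym : ∀ {u w} → T (adjU G u w) → T (adjU G w u)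
  adjU-sym h = let e , e∈ , j = to T-adjU h in from T-adjU (e , e∈ , ⊎-swap j)

  module _ {A : Set} (ℓ : Fin n → A) where

    Linked-sym : ∀ {u v} → Linked G ℓ u v → Linked G ℓ v u
    Linked-sym = Star.reverse (λ (adj , ℓ≡) → adjU-sym adj , sym ℓ≡)

    Linked-label : ∀ {u v} → Linked G ℓ u v → ℓ u ≡ ℓ v
    Linked-label = Star.fold (λ u v → ℓ u ≡ ℓ v) (λ (_ , ℓ≡) eq → trans (sym ℓ≡) eq) refl

    Linked-map : ∀ {B : Set} {ℓ′ : Fin n → B} →
                 (∀ {u w} → T (adjU G u w) → ℓ w ≡ ℓ u → ℓ′ w ≡ ℓ′ u) →
                 ∀ {u v} → Linked G ℓ u v → Linked G ℓ′ u v
    Linked-map keep = Star.map (λ (adj , ℓ≡) → adj , keep adj ℓ≡)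

  module _ {k : ℕ} (q : Fin n → Fin k) where

    walkIn-refl : ∀ m u → T (walkIn G q m u u)
    walkIn-refl zero    u = ≡ᶠ-refl u
    walkIn-refl (suc m) u = from (T-∨ {walkIn G q m u u}) (inj₁ (walkIn-refl m u))

    walkIn⇒Linked : ∀ m {u v} → T (walkIn G q m u v) → Linked G q u v
    walkIn⇒Linked zero    h = subst (Linked G q _) (to T-≡ᶠ h) ε
    walkIn⇒Linked (suc m) {u} {v} h with to (T-∨ {walkIn G q m u v}) h
    ... | inj₁ h′ = walkIn⇒Linked m h′
    ... | inj₂ h′ with w , hw ← Any.satisfied (any⁻ _ (allFin n) h′) =
      let adj , rest = to T-∧ hw ; q≡ , walk = to T-∧ rest in
      (adj , to T-≡ᶠ q≡) ◅ walkIn⇒Linked m walk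

    walkIn-bounded : ∀ m {u v} (s : Linked G q u v) → length (sources s) ≤ m → T (walkIn G q m u v)
    walkIn-bounded m ε _ = walkIn-refl m _
    walkIn-bounded (suc m) {u} {v} (_◅_ {j = w} (adj , q≡) s) (s≤s len) =
      from (T-∨ {walkIn G q m u v}) (inj₂ (any⁺ _ (lose {P = T ∘ P} (∈-allFin w) step)))
      where
      P : Fin n → Bool
      P w = adjU G u w ∧ (q w ≡ᶠ q u) ∧ walkIn G q m w v
      step : T (P w)
      step = from (T-∧ {adjU G u w})
                  (adj , from (T-∧ {q w ≡ᶠ q u}) (from T-≡ᶠ q≡ , walkIn-bounded m s len))

    Linked⇒walkIn : ∀ {u v} → Linked G q u v → T (walkIn G q n u v)
    Linked⇒walkIn s =
      let s′ , s′! = loop-erase _≟ᶠ_ s in walkIn-bounded n s′ (length-unique≤ s′!)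

    Linked? : Decidable (Linked G q)
    Linked? u v = map′ (walkIn⇒Linked n) Linked⇒walkIn (T? (walkIn G q n u v))

-- Linked? only decides Fin-valued labellings, so the colours are recoded in Fin B.
Linked-isDecEquivalence : ∀ {n} (G : MixedGraph n) {B} (c : Fin n → ℕ) → (∀ v → c v < B) →
                          IsDecEquivalence (Linked G c)
Linked-isDecEquivalence {n} G {B} c c< = record
  { isEquivalence = record { refl = ε ; sym = Linked-sym G c ; trans = _◅◅_ }
  ; _≟_           = λ u v → map′ (Linked-map G colour (λ _ → fromℕ<-injective _ _ (c< _) (c< _)))
                                 (Linked-map G c (λ _ c≡ → fromℕ<-cong _ _ c≡ (c< _) (c< _)))
                                 (Linked? G colour u v)
  }
  where
  colour : Fin n → Fin B
  colour v = fromℕ< (c< v)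

Increasing : ∀ {k} → List (Fin k × Fin k) → (Fin k → ℕ) → Set
Increasing D ψ = ∀ {d} → d ∈ D → ψ (proj₁ d) < ψ (proj₂ d)

module _ {k : ℕ} (D : List (Fin k × Fin k)) where

  dpath-increasing : ∀ {ψ} → Increasing D ψ → ∀ m {u v} → T (dpath D m u v) → ψ u < ψ v
  dpath-increasing {ψ} inc (suc m) {u} {v} h
    with d , d∈ , hd ← find (any⁻ _ D h)
    with d₁≡u , rest ← to T-∧ hd
    with to (T-∨ {proj₂ d ≡ᶠ v}) rest
  ... | inj₁ d₂≡v = subst₂ (λ a b → ψ a < ψ b) (to T-≡ᶠ d₁≡u) (to T-≡ᶠ d₂≡v) (inc d∈)
  ... | inj₂ path =
    <-trans (subst (λ a → ψ a < ψ (proj₂ d)) (to T-≡ᶠ d₁≡u) (inc d∈)) (dpath-increasing inc m path)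

  dpath-step : ∀ m {d} → d ∈ D → T (dpath D (suc m) (proj₁ d) (proj₂ d))
  dpath-step m {a , b} d∈ =
    any⁺ P (lose {P = T ∘ P} d∈
      (from (T-∧ {a ≡ᶠ a}) (≡ᶠ-refl a , from (T-∨ {b ≡ᶠ b}) (inj₁ (≡ᶠ-refl b)))))
    where
    P : Fin k × Fin k → Bool
    P e = (proj₁ e ≡ᶠ a) ∧ ((proj₂ e ≡ᶠ b) ∨ dpath D m (proj₂ e) b)

  prec-step : ∀ {d} → d ∈ D → T (prec D (proj₁ d) (proj₂ d))
  prec-step {fzero {m} , _}  = dpath-step m
  prec-step {fsuc {m} _ , _} = dpath-step m

  acyclic-increasing : ∀ {ψ} → Increasing D ψ → T (acyclic D)
  acyclic-increasing inc =
    from (T-all-allFin {k} _) λ v → from T-not λ cycle → <-irrefl refl (dpath-increasing inc k cycle)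

module _ {k : ℕ} where

  monotoneOn : List (Fin k × Fin k) → (Fin k → ℕ) → Bool
  monotoneOn D φ = all (λ a → all (λ b → not (prec D a b) ∨ (φ a <ᵇ φ b)) (allFin k)) (allFin k)

  aboveOn : (Fin k → Bool) → ℕ → (Fin k → ℕ) → Bool
  aboveOn C y φ = all (λ c → not (C c) ∨ (y <ᵇ φ c)) (allFin k)

  strictAbove : List (Fin k × Fin k) → (Fin k → Bool) → ℕ → (Fin k → ℕ) → Bool
  strictAbove D C y φ = monotoneOn D φ ∧ aboveOn C y φ

  Ω°-strictAbove : ∀ D C x y → Ω° D C x y ≡ length (filterᵇ (strictAbove D C y) (maps k (range x)))
  Ω°-strictAbove D C x y = refl

  monotoneOn⇒increasing : ∀ {D φ} → T (monotoneOn D φ) → Increasing D φ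
  monotoneOn⇒increasing {D} h {d} d∈ =
    <ᵇ⇒< _ _ (to T-→ (to (T-all-allFin _) (to (T-all-allFin _) h (proj₁ d)) (proj₂ d)) (prec-step D d∈))

  increasing⇒monotoneOn : ∀ {D φ} → Increasing D φ → T (monotoneOn D φ)
  increasing⇒monotoneOn {D} inc =
    from (T-all-allFin {k} _) λ a → from (T-all-allFin {k} _) λ b → from (T-→ {prec D a b}) λ p →
      <⇒<ᵇ (dpath-increasing D inc k p)

  T-aboveOn : ∀ {C y} {φ : Fin k → ℕ} → T (aboveOn C y φ) ⇔ (∀ {v} → T (C v) → y < φ v)
  T-aboveOn {C} = mk⇔
    (λ h {v} Cᵥ → <ᵇ⇒< _ _ (to T-→ (to (T-all-allFin _) h v) Cᵥ))
    (λ above → from (T-all-allFin {k} _) λ v → from (T-→ {C v}) λ Cᵥ → <⇒<ᵇ (above Cᵥ))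

  T-strictAbove : ∀ {D C y} {φ : Fin k → ℕ} →
                  T (strictAbove D C y φ) ⇔ (Increasing D φ × (∀ {v} → T (C v) → y < φ v))
  T-strictAbove {D} {C} {y} {φ} = mk⇔ split join
    where
    split : T (strictAbove D C y φ) → Increasing D φ × (∀ {v} → T (C v) → y < φ v)
    split h =
      let mono , above = to T-∧ h in monotoneOn⇒increasing {D} {φ} mono , to (T-aboveOn {C} {y} {φ}) above
    join : Increasing D φ × (∀ {v} → T (C v) → y < φ v) → T (strictAbove D C y φ)
    join (inc , above) =
      from (T-∧ {monotoneOn D φ}) (increasing⇒monotoneOn {D} {φ} inc , from (T-aboveOn {C} {y} {φ}) above)

orientBy : ∀ {k} → (Fin k → ℕ) → List (Fin k × Fin k) → List Bool
orientBy ψ = map (λ e → ψ (proj₁ e) <ᵇ ψ (proj₂ e))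

Separates : ∀ {k} → (Fin k → ℕ) → List (Fin k × Fin k) → Set
Separates ψ L = ∀ {e} → e ∈ L → ψ (proj₁ e) ≢ ψ (proj₂ e)

module _ {k : ℕ} {ψ : Fin k → ℕ} where

  orientBy-increasing : ∀ L → Separates ψ L → Increasing (orient (orientBy ψ L) L) ψ
  orientBy-increasing (e ∷ L) sep (here refl) with ψ (proj₁ e) <ᵇ ψ (proj₂ e) in lt
  ... | true  = <ᵇ⇒< _ _ (from T-≡ lt)
  ... | false = ≤∧≢⇒< (≮⇒≥ (to T-not (from T-not-≡ lt) ∘ <⇒<ᵇ)) (sep (here refl) ∘ sym)
  orientBy-increasing (e ∷ L) sep (there d∈) = orientBy-increasing L (sep ∘ there) d∈

  increasing⇒orientBy : ∀ o L → length o ≡ length L → Increasing (orient o L) ψ →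
                        o ≡ orientBy ψ L × Separates ψ L
  increasing⇒orientBy []      []      _   _   = refl , λ ()
  increasing⇒orientBy (b ∷ o) (e ∷ L) len inc =
    let o≡ , sep = increasing⇒orientBy o L (suc-injective len) (inc ∘ there) in
    cong₂ _∷_ (head-bit b (inc (here refl))) o≡ ,
    λ { (here refl) → head-separated b (inc (here refl)) ; (there e∈) → sep e∈ }
    where
    d : Bool → Fin k × Fin k
    d b = if b then e else (proj₂ e , proj₁ e)
    head-bit : ∀ b → ψ (proj₁ (d b)) < ψ (proj₂ (d b)) → b ≡ (ψ (proj₁ e) <ᵇ ψ (proj₂ e))
    head-bit true  lt = sym (to T-≡ (<⇒<ᵇ lt))
    head-bit false gt = sym (to T-not-≡ (from T-not (<-asym gt ∘ <ᵇ⇒< _ _)))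
    head-separated : ∀ b → ψ (proj₁ (d b)) < ψ (proj₂ (d b)) → ψ (proj₁ e) ≢ ψ (proj₂ e)
    head-separated true  lt = <⇒≢ lt
    head-separated false gt = <⇒≢ gt ∘ sym

orientBy-cong : ∀ {k} {ψ ψ′ : Fin k → ℕ} → ψ ≗ ψ′ → ∀ L → orientBy ψ L ≡ orientBy ψ′ L
orientBy-cong ψ≗ψ′ = map-cong (λ e → cong₂ _<ᵇ_ (ψ≗ψ′ (proj₁ e)) (ψ≗ψ′ (proj₂ e)))

module _ {n : ℕ} {k : ℕ} (q : Fin n → Fin k) where

  T-surjective : T (surjective q) ⇔ Onto q
  T-surjective = mk⇔
    (λ h j → let v , hᵥ = to (T-any-allFin _) (to (T-all-allFin _) h j) in v , to T-≡ᶠ hᵥ)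
    (λ onto → from (T-all-allFin {k} _) λ j →
       let v , eq = onto j in from (T-any-allFin {n} _) (v , from T-≡ᶠ eq))

  T-canonical : T (canonical q) ⇔ Canonical q
  T-canonical = mk⇔
    (λ h v {j} j< →
      let u , hᵤ = to (T-any-allFin _) (to T-→ (to (T-all-allFin _) (to (T-all-allFin _) h v) j) (<⇒<ᵇ j<))
          u< , qu≡ = to T-∧ hᵤ
      in u , <ᵇ⇒< _ _ u< , to T-≡ᶠ qu≡)
    (λ can → from (T-all-allFin {n} _) λ v → from (T-all-allFin {k} _) λ j →
       from (T-→ {toℕ j <ᵇ toℕ (q v)}) λ j< →
         let u , u< , qu≡ = can v (<ᵇ⇒< _ _ j<) in
         from (T-any-allFin {n} _) (u , from (T-∧ {toℕ u <ᵇ toℕ v}) (<⇒<ᵇ u< , from T-≡ᶠ qu≡)))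

  T-contracted : ∀ {j} → T (contracted q j) ⇔ ∃₂ λ a b → a ≢ b × q a ≡ j × q b ≡ j
  T-contracted {j} = mk⇔
    (λ h → let a , b , a≢b , a∈ , b∈ = from (two-members⇔2≤length block!) (≤ᵇ⇒≤ 2 _ h) in
           a , b , a≢b , inBlock a∈ , inBlock b∈)
    (λ (a , b , a≢b , qa≡ , qb≡) →
      ≤⇒≤ᵇ (to (two-members⇔2≤length block!) (a , b , a≢b , inBlock⁺ qa≡ , inBlock⁺ qb≡)))
    where
    P? : ∀ v → Dec (T (q v ≡ᶠ j))
    P? v = T? (q v ≡ᶠ j)
    block! : Unique (filter P? (allFin n))
    block! = filter⁺ P? {allFin n} (allFin⁺ n)
    inBlock : ∀ {a} → a ∈ filter P? (allFin n) → q a ≡ j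
    inBlock a∈ = to T-≡ᶠ (proj₂ (∈-filter⁻ P? {xs = allFin n} a∈))
    inBlock⁺ : ∀ {a} → q a ≡ j → a ∈ filter P? (allFin n)
    inBlock⁺ {a} qa≡ = ∈-filter⁺ P? (∈-allFin a) (from T-≡ᶠ qa≡)

  ∈-contractList⁺ : ∀ {es e} → e ∈ es → q (proj₁ e) ≢ q (proj₂ e) →
                    (q (proj₁ e) , q (proj₂ e)) ∈ contractList q es
  ∈-contractList⁺ e∈ q≢ = ∈-map⁺ _ (∈-filter⁺ (T? ∘ _) e∈ (from T-not (q≢ ∘ to T-≡ᶠ)))

  ∈-contractList⁻ : ∀ {es e′} → e′ ∈ contractList q es →
                    ∃ λ e → e ∈ es × q (proj₁ e) ≢ q (proj₂ e) ×
                            e′ ≡ (q (proj₁ e) , q (proj₂ e))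
  ∈-contractList⁻ e′∈ =
    let e , e∈ , e′≡ = ∈-map⁻ _ e′∈
        e∈es , sep = ∈-filter⁻ (T? ∘ _) e∈
    in e , e∈es , (λ eq → to T-not sep (from T-≡ᶠ eq)) , e′≡

record Proper {n} (G : MixedGraph n) (y : ℕ) (c : Fin n → ℕ) : Set where
  field
    edge : ∀ {u v} → (u , v) ∈ edges G → c u ≡ c v → y < c u
    arc  : ∀ {u v} → (u , v) ∈ arcs G → c v ≤ c u → y < c u

record IsFlat {n k} (G : MixedGraph n) (q : Fin n → Fin k) : Set where
  field
    onto        : Onto q
    isCanonical : Canonical q
    connected   : ∀ {u v} → q u ≡ q v → Linked G q u v

module _ {n : ℕ} (G : MixedGraph n) where

  module _ {y : ℕ} {c : Fin n → ℕ} where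

    T-properEdge : ∀ {u v} → T (properEdge y c (u , v)) ⇔ (c u ≡ c v → y < c u)
    T-properEdge {u} {v} = mk⇔
      (λ h c≡ → <ᵇ⇒< _ _ (to T-→ h (≡⇒≡ᵇ _ _ c≡)))
      (λ above → from (T-→ {c u ≡ᵇ c v}) λ h → <⇒<ᵇ (above (≡ᵇ⇒≡ _ _ h)))

    T-properArc : ∀ {u v} → T (properArc y c (u , v)) ⇔ (c v ≤ c u → y < c u)
    T-properArc {u} {v} = mk⇔ arc-above above-arc
      where
      arc-above : T (properArc y c (u , v)) → c v ≤ c u → y < c u
      arc-above h c≤ with to (T-∨ {c u <ᵇ c v}) h
      ... | inj₁ c< = contradiction (<ᵇ⇒< _ _ c<) (≤⇒≯ c≤)
      ... | inj₂ y< = <ᵇ⇒< _ _ y<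
      above-arc : (c v ≤ c u → y < c u) → T (properArc y c (u , v))
      above-arc above with c u <? c v
      ... | yes c< = from (T-∨ {c u <ᵇ c v}) (inj₁ (<⇒<ᵇ c<))
      ... | no  c≮ = from (T-∨ {c u <ᵇ c v}) (inj₂ (<⇒<ᵇ (above (≮⇒≥ c≮))))

    T-isColoring : T (isColoring G y c) ⇔ Proper G y c
    T-isColoring = mk⇔
      (λ h → let hₑ , hₐ = to T-∧ h in record
        { edge = λ e∈ → to T-properEdge (All.lookup (all⁺ _ (edges G) hₑ) e∈)
        ; arc  = λ e∈ → to T-properArc (All.lookup (all⁺ _ (arcs G) hₐ) e∈) })
      (λ p → from (T-∧ {all (properEdge y c) (edges G)})
        ( all⁻ (properEdge y c) (All.tabulate λ { {_ , _} e∈ → from T-properEdge (Proper.edge p e∈) })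
        , all⁻ (properArc y c) (All.tabulate λ { {_ , _} e∈ → from T-properArc (Proper.arc p e∈) })))

  T-isFlat : ∀ {k} {q : Fin n → Fin k} → T (isFlat G q) ⇔ IsFlat G q
  T-isFlat {k} {q} = mk⇔
    (λ h → let hₛ , rest = to T-∧ h ; h꜀ , hₗ = to (T-∧ {canonical q}) rest in record
      { onto        = to (T-surjective q) hₛ
      ; isCanonical = to (T-canonical q) h꜀
      ; connected   = λ {u} {v} q≡ →
          walkIn⇒Linked G q n (to T-→ (to (T-all-allFin _) (to (T-all-allFin _) hₗ u) v) (from T-≡ᶠ q≡)) })
    (λ flat → from (T-∧ {surjective q}) (from (T-surjective q) (IsFlat.onto flat) ,
               from (T-∧ {canonical q}) (from (T-canonical q) (IsFlat.isCanonical flat) ,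
               from (T-all-allFin {n} _) λ u → from (T-all-allFin {n} _) λ v →
               from (T-→ {q u ≡ᶠ q v}) λ h →
                 Linked⇒walkIn G q (IsFlat.connected flat (to T-≡ᶠ h)))))

module _ {n : ℕ} (G : MixedGraph n) {k : ℕ} (q : Fin n → Fin k) where

  flatLinks : List (Fin k × Fin k)
  flatLinks = flatEdges G q ++ flatArcs G q

  ∈-flatLinks⁺ : ∀ {e} → e ∈ edges G ++ arcs G → q (proj₁ e) ≢ q (proj₂ e) →
                 (q (proj₁ e) , q (proj₂ e)) ∈ flatLinks
  ∈-flatLinks⁺ e∈ q≢ with ∈-++⁻ (edges G) e∈
  ... | inj₁ e∈E = ∈-++⁺ˡ (∈-contractList⁺ q e∈E q≢)
  ... | inj₂ e∈A = ∈-++⁺ʳ (flatEdges G q) (∈-contractList⁺ q e∈A q≢)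

  ∈-flatLinks⁻ : ∀ {e′} → e′ ∈ flatLinks →
                 ∃ λ e → e ∈ edges G ++ arcs G × q (proj₁ e) ≢ q (proj₂ e) ×
                         e′ ≡ (q (proj₁ e) , q (proj₂ e))
  ∈-flatLinks⁻ e′∈ with ∈-++⁻ (flatEdges G q) e′∈
  ... | inj₁ e′∈E = let e , e∈ , rest = ∈-contractList⁻ q {edges G} e′∈E in e , ∈-++⁺ˡ e∈ , rest
  ... | inj₂ e′∈A = let e , e∈ , rest = ∈-contractList⁻ q {arcs G} e′∈A in e , ∈-++⁺ʳ (edges G) e∈ , rest

  T-inT-orientBy : ∀ {ψ v} → T (inT G q (orientBy ψ flatLinks) v) ⇔
                   ∃ λ a → a ∈ flatArcs G q × ψ (proj₂ a) ≤ ψ (proj₁ a) × proj₁ a ≡ v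
  T-inT-orientBy {ψ} {v} = mk⇔
    (λ h → let p , p∈ , hₚ = find (any⁻ P (map (λ a → bit a , a) (flatArcs G q))
                                          (subst (T ∘ any P) pairs≡ h))
               a , a∈ , p≡ = ∈-map⁻ (λ a → bit a , a) p∈
               reversed , a₁≡v = to T-∧ (subst (T ∘ P) p≡ hₚ)
           in a , a∈ , ≮⇒≥ (to T-not reversed ∘ <⇒<ᵇ) , to T-≡ᶠ a₁≡v)
    (λ (a , a∈ , a≤ , a₁≡v) → subst (T ∘ any P) (sym pairs≡)
      (any⁺ P (lose {P = T ∘ P} (∈-map⁺ _ a∈)
        (from (T-∧ {not (bit a)}) (from T-not (≤⇒≯ a≤ ∘ <ᵇ⇒< _ _) , from T-≡ᶠ a₁≡v)))))
    where
    bit : Fin k × Fin k → Bool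
    bit e = ψ (proj₁ e) <ᵇ ψ (proj₂ e)
    P : Bool × (Fin k × Fin k) → Bool
    P p = not (proj₁ p) ∧ (proj₁ (proj₂ p) ≡ᶠ v)
    pairs≡ : zip (drop (length (flatEdges G q)) (orientBy ψ flatLinks)) (flatArcs G q) ≡
             map (λ a → bit a , a) (flatArcs G q)
    pairs≡ = trans (cong (λ bs → zip bs (flatArcs G q)) (drop-map-++ bit (flatEdges G q) (flatArcs G q)))
                   (zip-map-self bit (flatArcs G q))

-- Lifts of a colouring

module _ {n : ℕ} (G : MixedGraph n) (y : ℕ) (c : Fin n → ℕ) where

  -- A flat q with φ ∘ q = c which, oriented by increasing φ, gives a term of the right-hand side.
  record Lift {k} (q : Fin n → Fin k) (φ : Fin k → ℕ) : Set where
    field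
      factors          : ∀ v → φ (q v) ≡ c v
      separates        : Separates φ (flatLinks G q)
      contracted-above : ∀ {j} → T (contracted q j) → y < φ j
      reversed-above   : ∀ {a} → a ∈ flatArcs G q → φ (proj₂ a) ≤ φ (proj₁ a) → y < φ (proj₁ a)

  module _ {k : ℕ} {q : Fin n → Fin k} {φ : Fin k → ℕ} (lift : Lift q φ) where

    open Lift lift

    private
      φ-equal : ∀ a b → c a ≡ c b → φ (q a) ≡ φ (q b)
      φ-equal a b c≡ = trans (factors a) (trans c≡ (sym (factors b)))

    lift-step-in-block : ∀ {u w} → T (adjU G u w) → c w ≡ c u → q w ≡ q u
    lift-step-in-block {u} {w} adj c≡ with q w ≟ᶠ q u
    ... | yes q≡ = q≡
    ... | no  q≢ with to (T-adjU G) adj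
    ...   | _ , e∈ , inj₁ refl = contradiction (φ-equal u w (sym c≡)) (separates (∈-flatLinks⁺ G q e∈ (q≢ ∘ sym)))
    ...   | _ , e∈ , inj₂ refl = contradiction (φ-equal w u c≡)       (separates (∈-flatLinks⁺ G q e∈ q≢))

    lift-canonicalLabelling : IsFlat G q → CanonicalLabelling (Linked G c) k q
    lift-canonicalLabelling flat = record
      { onto        = IsFlat.onto flat
      ; isCanonical = IsFlat.isCanonical flat
      ; kernel      = mk⇔
          (Linked-map G q (λ {u} {w} _ q≡ → trans (sym (factors w)) (trans (cong φ q≡) (factors u)))
           ∘ IsFlat.connected flat)
          (Linked-label G q ∘ Linked-map G c lift-step-in-block)
      }

    lift-proper : Loopless G → IsFlat G q → Proper G y c
    lift-proper (edges-loopless , arcs-loopless) flat = record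
      { edge = λ {u} {v} e∈ c≡ →
          same-block-above (All.lookup edges-loopless e∈)
            (sym (lift-step-in-block (from (T-adjU G) (_ , ∈-++⁺ˡ e∈ , inj₁ refl)) (sym c≡)))
      ; arc  = λ {u} {v} e∈ c≤ → arc-above e∈ c≤ (q u ≟ᶠ q v) (All.lookup arcs-loopless e∈)
      }
      where
      same-block-above : ∀ {u v} → u ≢ v → q u ≡ q v → y < c u
      same-block-above {u} {v} u≢v q≡ =
        subst (y <_) (factors u) (contracted-above (from (T-contracted q) (u , v , u≢v , refl , sym q≡)))
      arc-above : ∀ {u v} → (u , v) ∈ arcs G → c v ≤ c u → Dec (q u ≡ q v) → u ≢ v → y < c u
      arc-above e∈ c≤ (yes q≡) u≢v = same-block-above u≢v q≡
      arc-above {u} {v} e∈ c≤ (no q≢) _ =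
        subst (y <_) (factors u)
          (reversed-above (∈-contractList⁺ q e∈ q≢) (subst₂ _≤_ (sym (factors v)) (sym (factors u)) c≤))

  module _ (proper : Proper G y c) where

    monochromatic-above : ∀ {u w} → T (adjU G u w) → c w ≡ c u → y < c u
    monochromatic-above adj c≡ with e , e∈ , joins ← to (T-adjU G) adj with ∈-++⁻ (edges G) e∈ | joins
    ... | inj₁ e∈E | inj₁ refl = Proper.edge proper e∈E (sym c≡)
    ... | inj₁ e∈E | inj₂ refl = subst (y <_) c≡ (Proper.edge proper e∈E c≡)
    ... | inj₂ e∈A | inj₁ refl = Proper.arc proper e∈A (≤-reflexive c≡)
    ... | inj₂ e∈A | inj₂ refl = subst (y <_) c≡ (Proper.arc proper e∈A (≤-reflexive (sym c≡)))

    canonicalLabelling-lift : ∀ {k} {q : Fin n → Fin k} {ψ : Fin k → ℕ} →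
                              CanonicalLabelling (Linked G c) k q → (∀ v → ψ (q v) ≡ c v) →
                              IsFlat G q × Lift q ψ
    canonicalLabelling-lift {q = q} {ψ} L factors = flat , record
      { factors          = factors
      ; separates        = separates
      ; contracted-above = contracted-above
      ; reversed-above   = reversed-above
      }
      where
      open CanonicalLabelling L

      step-in-block : ∀ {u w} → T (adjU G u w) → c w ≡ c u → q u ≡ q w
      step-in-block adj c≡ = from kernel ((adj , c≡) ◅ ε)

      ψ≡⇒c≡ : ∀ {a b} → ψ (q a) ≡ ψ (q b) → c b ≡ c a
      ψ≡⇒c≡ {a} {b} ψ≡ = trans (sym (factors b)) (trans (sym ψ≡) (factors a))

      flat : IsFlat G q
      flat = record
        { onto        = onto
        ; isCanonical = isCanonical
        ; connected   = Linked-map G c (λ adj c≡ → sym (step-in-block adj c≡)) ∘ to kernel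
        }

      separates : Separates ψ (flatLinks G q)
      separates e′∈ with e , e∈ , q≢ , refl ← ∈-flatLinks⁻ G q e′∈ =
        q≢ ∘ step-in-block (from (T-adjU G) (e , e∈ , inj₁ refl)) ∘ ψ≡⇒c≡

      contracted-above : ∀ {j} → T (contracted q j) → y < ψ j
      contracted-above h with a , b , a≢b , refl , qb≡ ← to (T-contracted q) h with to kernel (sym qb≡)
      ... | ε               = contradiction refl a≢b
      ... | (adj , c≡) ◅ _  = subst (y <_) (sym (factors a)) (monochromatic-above adj c≡)

      reversed-above : ∀ {a} → a ∈ flatArcs G q → ψ (proj₂ a) ≤ ψ (proj₁ a) → y < ψ (proj₁ a)
      reversed-above a∈ ψ≤ with e , e∈ , _ , refl ← ∈-contractList⁻ q {arcs G} a∈ =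
        subst (y <_) (sym (factors (proj₁ e)))
          (Proper.arc proper e∈ (subst₂ _≤_ (factors (proj₂ e)) (factors (proj₁ e)) ψ≤))

-- Fibres of the right-hand side

module Fibres {n : ℕ} (G : MixedGraph n) (x y : ℕ) where

  colourings : List (Fin n → ℕ)
  colourings = maps n (range x)

  module _ {k : ℕ} (q : Fin n → Fin k) where

    oriented : List Bool → List (Fin k × Fin k)
    oriented o = orient o (flatLinks G q)

    celeste : List Bool → Fin k → Bool
    celeste o v = contracted q v ∨ inT G q o v

  -- fibre c counts the terms (k, q, o, φ) of flatSum G x y with φ ∘ q = c.
  module _ (c : Fin n → ℕ) where

    φ-term : ∀ {k} → (Fin n → Fin k) → List Bool → (Fin k → ℕ) → ℕ
    φ-term q o φ = if strictAbove (oriented q o) (celeste q o) y φ then 𝟙 ((φ ∘ q) ≗? c) else 0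

    o-term : ∀ {k} → (Fin n → Fin k) → List Bool → ℕ
    o-term {k} q o = if acyclic (oriented q o) then sum (map (φ-term q o) (maps k (range x))) else 0

    q-term : ∀ {k} → (Fin n → Fin k) → ℕ
    q-term q = if isFlat G q then sum (map (o-term q) (bools (length (flatLinks G q)))) else 0

    k-term : ℕ → ℕ
    k-term k = sum (map q-term (maps n (allFin k)))

    fibre : ℕ
    fibre = sum (map k-term (upTo (suc n)))

  Ω°≡ : ∀ {k} (q : Fin n → Fin k) o →
        Ω° (oriented q o) (celeste q o) x y ≡
        sum (map (λ c → sum (map (φ-term c q o) (maps k (range x)))) colourings)
  Ω°≡ {k} q o = begin
    Ω° (oriented q o) (celeste q o) x y
      ≡⟨ Ω°-strictAbove (oriented q o) (celeste q o) x y ⟩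
    length (filterᵇ strict Φ)
      ≡⟨ length-filterᵇ strict Φ ⟩
    sum (map (λ φ → if strict φ then 1 else 0) Φ)
      ≡⟨ sum-map-cong Φ (λ {φ} φ∈ → cong (λ m → if strict φ then m else 0) (counted-once φ∈)) ⟨
    sum (map (λ φ → if strict φ then sum (map (λ c → 𝟙 ((φ ∘ q) ≗? c)) colourings) else 0) Φ)
      ≡⟨ sum-map-if-comm strict _ Φ colourings ⟩
    sum (map (λ c → sum (map (φ-term c q o) Φ)) colourings)
      ∎
    where
    open ≡-Reasoning
    Φ : List (Fin k → ℕ)
    Φ = maps k (range x)
    strict : (Fin k → ℕ) → Bool
    strict = strictAbove (oriented q o) (celeste q o) y
    counted-once : ∀ {φ} → φ ∈ Φ → sum (map (λ c → 𝟙 ((φ ∘ q) ≗? c)) colourings) ≡ 1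
    counted-once {φ} φ∈ =
      let g , g∈ , g≗ = ∈-maps⁺ n (φ ∘ q) (λ v → ∈-maps⁻ k φ∈ (q v)) in
      sum-map-𝟙≡1 (Fin n →-setoid ℕ) _≗?_ (φ ∘ q) (maps-unique n (range-unique x))
                  (g , g∈ , sym ∘ g≗)

  flatTerm≡ : ∀ {k} (q : Fin n → Fin k) →
              flatTerm G q x y ≡
              sum (map (λ c → sum (map (o-term c q) (bools (length (flatLinks G q))))) colourings)
  flatTerm≡ {k} q =
    sum-map-filterᵇ-comm (λ o → acyclic (oriented q o)) (λ o → Ω° (oriented q o) (celeste q o) x y)
      (λ o c → sum (map (φ-term c q o) (maps k (range x)))) (bools (length (flatLinks G q))) colourings (Ω°≡ q)

  flatSum≡ : flatSum G x y ≡ sum (map fibre colourings)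
  flatSum≡ = begin
    flatSum G x y
      ≡⟨ cong sum (map-cong (λ k → sum-map-filterᵇ-comm (isFlat G) (λ q → flatTerm G q x y)
                                     (λ q c → sum (map (o-term c q) (bools (length (flatLinks G q)))))
                                     (maps n (allFin k)) colourings flatTerm≡)
                            (upTo (suc n))) ⟩
    sum (map (λ k → sum (map (λ c → k-term c k) colourings)) (upTo (suc n)))
      ≡⟨ sum-map-comm (λ k c → k-term c k) (upTo (suc n)) colourings ⟩
    sum (map fibre colourings)
      ∎
    where open ≡-Reasoning

  module _ {c : Fin n → ℕ} where

    φ-term-positive : ∀ {k} {q : Fin n → Fin k} {o φ} → 0 < φ-term c q o φ →
                      Increasing (oriented q o) φ × (∀ {v} → T (celeste q o v) → y < φ v) ×
                      (∀ v → φ (q v) ≡ c v)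
    φ-term-positive {q = q} {o} {φ} pos =
      let strict , pos′ = if-positive (strictAbove (oriented q o) (celeste q o) y φ) pos
          inc , above = to T-strictAbove strict
      in inc , above , 𝟙-positive ((φ ∘ q) ≗? c) pos′

    o-term-positive : ∀ {k} {q : Fin n → Fin k} {o} → o ∈ bools (length (flatLinks G q)) →
                      0 < o-term c q o → ∃ λ φ → o ≡ orientBy φ (flatLinks G q) × Lift G y c q φ
    o-term-positive {k} {q} {o} o∈ pos =
      let _ , pos′ = if-positive (acyclic (oriented q o)) pos
          φ , _ , pos″ = sum-map-positive (φ-term c q o) (maps k (range x)) pos′
          inc , above , factors = φ-term-positive {q = q} pos″
          o≡ , separates = increasing⇒orientBy {ψ = φ} o (flatLinks G q) (∈-bools⁻ _ o∈) inc
          reversed : ∀ {a} → a ∈ flatArcs G q → φ (proj₂ a) ≤ φ (proj₁ a) → T (inT G q o (proj₁ a))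
          reversed a∈ φ≤ =
            subst (λ o → T (inT G q o _)) (sym o≡) (from (T-inT-orientBy G q {φ}) (_ , a∈ , φ≤ , refl))
      in φ , o≡ , record
           { factors          = factors
           ; separates        = separates
           ; contracted-above = λ {j} h → above (from (T-∨ {contracted q j} {inT G q o j}) (inj₁ h))
           ; reversed-above   = λ {a} a∈ φ≤ →
               above (from (T-∨ {contracted q (proj₁ a)} {inT G q o (proj₁ a)}) (inj₂ (reversed a∈ φ≤)))
           }

    q-term-positive : ∀ {k} {q : Fin n → Fin k} → 0 < q-term c q → IsFlat G q × ∃ (Lift G y c q)
    q-term-positive {q = q} pos =
      let flat , pos′ = if-positive (isFlat G q) pos
          o , o∈ , pos″ = sum-map-positive (o-term c q) (bools (length (flatLinks G q))) pos′
          φ , _ , lift = o-term-positive o∈ pos″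
      in to (T-isFlat G) flat , φ , lift

    q-term-positive⇒labelling : ∀ {k} {q : Fin n → Fin k} → 0 < q-term c q →
                                CanonicalLabelling (Linked G c) k q
    q-term-positive⇒labelling pos =
      let flat , _ , lift = q-term-positive pos in lift-canonicalLabelling G y c lift flat

    k-term-positive⇒labelling : ∀ {k} → 0 < k-term c k →
                                ∃ λ (q : Fin n → Fin k) → CanonicalLabelling (Linked G c) k q
    k-term-positive⇒labelling {k} pos =
      let q , _ , pos′ = sum-map-positive (q-term c) (maps n (allFin k)) pos
      in q , q-term-positive⇒labelling {q = q} pos′

    fibre-positive⇒proper : Loopless G → 0 < fibre c → Proper G y c
    fibre-positive⇒proper loopless pos =
      let k , _ , pos′ = sum-map-positive (k-term c) (upTo (suc n)) pos
          q , _ , pos″ = sum-map-positive (q-term c) (maps n (allFin k)) pos′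
          flat , _ , lift = q-term-positive {q = q} pos″
      in lift-proper G y c lift loopless flat

    φ-sum≤1 : ∀ {k} {q : Fin n → Fin k} {o} → Onto q → sum (map (φ-term c q o) (maps k (range x))) ≤ 1
    φ-sum≤1 {k} {q} {o} onto =
      sum-map≤1 (Fin k →-setoid ℕ) (φ-term c q o) (maps-unique k (range-unique x))
        (λ {φ} _ → if≤1 _ (𝟙≤1 ((φ ∘ q) ≗? c)))
        (λ {φ} {φ′} _ _ pos pos′ → onto-factor-unique onto (factors φ pos) (factors φ′ pos′))
      where
      factors : ∀ φ → 0 < φ-term c q o φ → ∀ v → φ (q v) ≡ c v
      factors φ pos = proj₂ (proj₂ (φ-term-positive {q = q} {o} {φ} pos))

    o-sum≤1 : ∀ {k} {q : Fin n → Fin k} → Onto q →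
              sum (map (o-term c q) (bools (length (flatLinks G q)))) ≤ 1
    o-sum≤1 {k} {q} onto =
      sum-map≤1 (setoid (List Bool)) (o-term c q) (bools-unique (length (flatLinks G q)))
                (λ _ → if≤1 _ (φ-sum≤1 onto)) same-o
      where
      same-o : ∀ {o o′} → o ∈ _ → o′ ∈ _ → 0 < o-term c q o → 0 < o-term c q o′ → o ≡ o′
      same-o o∈ o′∈ pos pos′ =
        let φ  , o≡  , lift  = o-term-positive o∈ pos
            φ′ , o′≡ , lift′ = o-term-positive o′∈ pos′
            φ≗φ′ = onto-factor-unique onto (Lift.factors lift) (Lift.factors lift′)
        in trans o≡ (trans (orientBy-cong {ψ = φ} {φ′} φ≗φ′ (flatLinks G q)) (sym o′≡))

    q-term≤1 : ∀ {k} (q : Fin n → Fin k) → q-term c q ≤ 1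
    q-term≤1 q with isFlat G q in flat
    ... | true  = o-sum≤1 (IsFlat.onto (to (T-isFlat G) (from T-≡ flat)))
    ... | false = z≤n

    k-term≤1 : ∀ k → k-term c k ≤ 1
    k-term≤1 k =
      sum-map≤1 (Fin n →-setoid Fin k) (q-term c) (maps-unique n (allFin⁺ k)) (λ {q} _ → q-term≤1 q)
      λ {q} {q′} _ _ pos pos′ → toℕ-injective ∘ proj₂ (canonicalLabelling-unique
        (q-term-positive⇒labelling {q = q} pos) (q-term-positive⇒labelling {q = q′} pos′))

    fibre≤1 : fibre c ≤ 1
    fibre≤1 = sum-map≤1 (setoid ℕ) (k-term c) (upTo⁺ (suc n)) (λ {k} _ → k-term≤1 k)
      λ {k} {k′} _ _ pos pos′ → proj₁ (canonicalLabelling-unique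
        (proj₂ (k-term-positive⇒labelling {k} pos)) (proj₂ (k-term-positive⇒labelling {k′} pos′)))

    lift⇒q-term-positive : ∀ {k} {q : Fin n → Fin k} {ψ} → IsFlat G q → Lift G y c q ψ →
                           ψ ∈ maps k (range x) → 1 ≤ q-term c q
    lift⇒q-term-positive {k} {q} {ψ} flat lift ψ∈ = begin
      1                                              ≡⟨ 𝟙-yes ((ψ ∘ q) ≗? c) factors ⟨
      𝟙 ((ψ ∘ q) ≗? c)                               ≡⟨ if-T _ (from T-strictAbove (increasing , above)) ⟨
      φ-term c q o ψ                                 ≤⟨ ≤-sum-map (φ-term c q o) ψ∈ ⟩
      sum (map (φ-term c q o) (maps k (range x)))    ≡⟨ if-T _ (acyclic-increasing (oriented q o) increasing) ⟨
      o-term c q o                                   ≤⟨ ≤-sum-map (o-term c q) o∈ ⟩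
      sum (map (o-term c q) (bools (length links)))  ≡⟨ if-T _ (from (T-isFlat G) flat) ⟨
      q-term c q                                     ∎
      where
      open ≤-Reasoning
      open Lift lift
      links : List (Fin k × Fin k)
      links = flatLinks G q
      o : List Bool
      o = orientBy ψ links
      o∈ : o ∈ bools (length links)
      o∈ = subst (λ m → o ∈ bools m) (length-map _ links) (∈-bools⁺ o)
      increasing : Increasing (oriented q o) ψ
      increasing = orientBy-increasing links separates
      above : ∀ {v} → T (celeste q o v) → y < ψ v
      above {v} h with to (T-∨ {contracted q v}) h
      ... | inj₁ h′ = contracted-above h′
      ... | inj₂ h′ with a , a∈ , ψ≤ , refl ← to (T-inT-orientBy G q) h′ = reversed-above a∈ ψ≤

    listed-labelling : c ∈ colourings → ∃₂ λ k (q : Fin n → Fin k) →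
                       k ≤ n × q ∈ maps n (allFin k) × CanonicalLabelling (Linked G c) k q
    listed-labelling c∈ =
      let k , q₀ , k≤n , L₀ = canonicalLabelling (Linked-isDecEquivalence G c colour<)
          q , q∈ , q≗q₀ = ∈-maps⁺ n q₀ (λ _ → ∈-allFin _)
      in k , q , k≤n , q∈ , canonicalLabelling-cong (sym ∘ q≗q₀) L₀
      where
      colour< : ∀ v → c v < suc x
      colour< v = ∈-range⁻ (∈-maps⁻ n c∈ v)

    listed-colours : c ∈ colourings → ∀ {k} {q : Fin n → Fin k} → CanonicalLabelling (Linked G c) k q →
                     ∃ λ ψ → ψ ∈ maps k (range x) × (∀ v → ψ (q v) ≡ c v)
    listed-colours c∈ {k} {q} L =
      let ψ , ψ∈ , ψ≗ = ∈-maps⁺ k (c ∘ representative) (λ j → ∈-maps⁻ n c∈ (representative j))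
      in ψ , ψ∈ , λ v → trans (ψ≗ (q v)) (Linked-label G c (to kernel (proj₂ (onto (q v)))))
      where
      open CanonicalLabelling L
      representative : Fin k → Fin n
      representative j = proj₁ (onto j)

    proper⇒fibre-positive : Proper G y c → c ∈ colourings → 1 ≤ fibre c
    proper⇒fibre-positive proper c∈ =
      let k , q , k≤n , q∈ , L = listed-labelling c∈
          ψ , ψ∈ , factors = listed-colours c∈ L
          flat , lift = canonicalLabelling-lift G y c proper L factors
      in begin
           1          ≤⟨ lift⇒q-term-positive flat lift ψ∈ ⟩
           q-term c q ≤⟨ ≤-sum-map (q-term c) q∈ ⟩
           k-term c k ≤⟨ ≤-sum-map (k-term c) (∈-upTo⁺ (s≤s k≤n)) ⟩
           fibre c    ∎
      where open ≤-Reasoning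

  fibre≡ : Loopless G → ∀ {c} → c ∈ colourings → fibre c ≡ (if isColoring G y c then 1 else 0)
  fibre≡ loopless {c} c∈ with isColoring G y c in colouring
  ... | true  = ≤-antisym fibre≤1 (proper⇒fibre-positive (to (T-isColoring G) (from T-≡ colouring)) c∈)
  ... | false = n≤0⇒n≡0 (≮⇒≥ λ pos →
                  to T-not (from T-not-≡ colouring) (from (T-isColoring G) (fibre-positive⇒proper loopless pos)))

theorem4p1 : (n : ℕ) (G : MixedGraph n) → Loopless G →
             (x y : ℕ) → 1 ≤ y → y ≤ x →
             χ G x y ≡ flatSum G x y
-- The identity holds for all x and y.
theorem4p1 n G loopless x y _ _ = begin
  χ G x y
    ≡⟨ length-filterᵇ (isColoring G y) colourings ⟩
  sum (map (λ c → if isColoring G y c then 1 else 0) colourings)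
    ≡⟨ sum-map-cong colourings (sym ∘ fibre≡ loopless) ⟩
  sum (map fibre colourings)
    ≡⟨ flatSum≡ ⟨
  flatSum G x y
    ∎
  where
  open ≡-Reasoning
  open Fibres G x y
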